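{- Let $\mathcal{G}=(G,\lambda)$ be a simple temporal clique with $G=(V,E)$, and let $E^+_T$ and the collectors be as defined below (for any of the arbitrary choices allowed). Then the backward fireworks cover $S^+_T=\{\{u,v\}: (u,v)\in E^+_T\}\cup\{\{u,v\}\in E: u\text{ is a collector}\}$ is a temporal spanner of $\mathcal{G}$.
   Context: A simple temporal clique is a pair $\mathcal{G}=(G,\lambda)$ where $G=(V,E)$ is the complete graph on a finite vertex set $V$ with $|V|\ge 2$, and $\lambda:E\to\mathbb{N}$ assigns each edge a single label such that any two distinct edges sharing an endpoint have distinct labels. A journey from $x$ to $y$ is a sequence of edges $\{u_1,u_2\},\dots,\{u_k,u_{k+1}\}$ ($k\ge1$) with $u_1=x$, $u_{k+1}=y$, the $u_i$ pairwise distinct, and strictly increasing labels. A subset $E'\subseteq E$ is a temporal spanner of $\mathcal{G}$ if for every ordered pair of distinct vertices $x,y$ there is a journey from $x$ to $y$ using only edges of $E'$. For a vertex $v$, $e^+(v)$ denotes the edge incident to $v$ with the largest label. Let $E^+$ be the set of arcs on $V$ containing, for each vertex $v$ with $e^+(v)=\{u,v\}$, the arc $(v,u)$, except that whenever $e^+(u)=e^+(v)$ only one of $(u,v),(v,u)$ is included (chosen arbitrarily). A source of $E^+$ is a vertex of in-degree $0$ in $(V,E^+)$. $E^+_T$ is obtained from $E^+$ as follows: for every vertex $v$ of in-degree at least $2$ in $E^+$, let $(u_1,v),\dots,(u_\ell,v)$ be its in-arcs where $(u_\ell,v)$ has the smallest label; for each $i<\ell$, if $u_i$ is a source of $E^+$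 replace $(u_i,v)$ by $(v,u_i)$, otherwise delete $(u_i,v)$. The collectors are the vertices of in-degree $0$ in $(V,E^+_T)$. -}

module Defs where

open import Data.Nat using (ℕ; _<_)
open import Data.Fin using (Fin)
open import Data.Bool using (Bool; true; false)
open import Data.List using (List; []; _∷_; _++_)
open import Data.List.Relation.Unary.Linked using (Linked)
open import Data.List.Relation.Unary.Unique.Propositional using (Unique)
open import Data.Product using (Σ; _×_; ∃)
open import Data.Sum using (_⊎_)
open import Data.Unit using (⊤)
open import Relation.Binary.PropositionalEquality using (_≡_; _≢_)
open import Relation.Nullary using (¬_)

-- Vertices are Fin n. A labelling of the complete graph K_n is a function
-- lab : Fin n → Fin n → ℕ, where lab u v (u ≢ v) is the label of edge {u,v};
-- diagonal values are irrelevant.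

Labelling : ℕ → Set
Labelling n = Fin n → Fin n → ℕ

Symmetric : ∀ {n} → Labelling n → Set
Symmetric {n} lab = (u v : Fin n) → lab u v ≡ lab v u

LocallyProper : ∀ {n} → Labelling n → Set
LocallyProper {n} lab =
  (u v w : Fin n) → u ≢ v → u ≢ w → v ≢ w → lab u v ≢ lab u w

record SimpleTemporalClique (n : ℕ) (lab : Labelling n) : Set where
  field
    symmetric : Symmetric lab
    proper    : LocallyProper lab

-- Top lab v u : e⁺(v) = {v,u}, i.e. {v,u} is the edge at v of largest label
Top : ∀ {n} → Labelling n → Fin n → Fin n → Set
Top {n} lab v u = u ≢ v × ((w : Fin n) → w ≢ v → w ≢ u → lab v w < lab v u)

Arcs : ℕ → Set
Arcs n = Fin n → Fin n → Bool

-- A is one of the admissible choices of E⁺: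
--  every arc (a,b) has e⁺(a) = {a,b};
--  if e⁺(a) = {a,b} ≠ e⁺(b) then (a,b) is an arc;
--  if e⁺(a) = e⁺(b) = {a,b} then exactly one of (a,b), (b,a) is an arc.
IsEPlus : ∀ {n} → Labelling n → Arcs n → Set
IsEPlus {n} lab A =
    ((a b : Fin n) → A a b ≡ true → Top lab a b)
  × ((a b : Fin n) → Top lab a b → ¬ Top lab b a → A a b ≡ true)
  × ((a b : Fin n) → Top lab a b → Top lab b a →
       (A a b ≡ true ⊎ A b a ≡ true) × ¬ (A a b ≡ true × A b a ≡ true))

Source : ∀ {n} → Arcs n → Fin n → Set
Source {n} A v = (u : Fin n) → A u v ≡ false

-- (a,b) ∈ E⁺_T :
--  either (a,b) ∈ E⁺ and it has the smallest label among the in-arcs of b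
--  (so it is neither deleted nor reversed), or
--  (b,a) ∈ E⁺ was reversed: b is a source of E⁺ and a has another in-arc
--  (u,a) of smaller label.
ArcT : ∀ {n} → Labelling n → Arcs n → Fin n → Fin n → Set
ArcT {n} lab A a b =
    (A a b ≡ true × ((u : Fin n) → A u b ≡ true → u ≢ a → lab a b < lab u b))
  ⊎ (A b a ≡ true × Source A b ×
       Σ (Fin n) (λ u → A u a ≡ true × u ≢ b × lab u a < lab b a))

Collector : ∀ {n} → Labelling n → Arcs n → Fin n → Set
Collector {n} lab A c = (u : Fin n) → ¬ ArcT lab A u c

InCover : ∀ {n} → Labelling n → Arcs n → Fin n → Fin n → Set
InCover lab A a b =
  ArcT lab A a b ⊎ ArcT lab A b a ⊎ Collector lab A a ⊎ Collector lab A b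

IncreasingLabels : ∀ {n} → Labelling n → List (Fin n) → Set
IncreasingLabels lab (a ∷ b ∷ c ∷ rest) =
  lab a b < lab b c × IncreasingLabels lab (b ∷ c ∷ rest)
IncreasingLabels lab _ = ⊤

Journey : ∀ {n} → Labelling n → (Fin n → Fin n → Set) → Fin n → Fin n → Set
Journey {n} lab S x y =
  Σ (List (Fin n)) λ mid →
      Unique (x ∷ mid ++ y ∷ [])
    × Linked S (x ∷ mid ++ y ∷ [])
    × IncreasingLabels lab (x ∷ mid ++ y ∷ [])

TemporalSpanner : ∀ {n} → Labelling n → (Fin n → Fin n → Set) → Set
TemporalSpanner {n} lab S = (x y : Fin n) → x ≢ y → Journey lab S x y

-- Walk backwards from y along arcs of E⁺_T. For consecutive arcs u → v → z of E⁺_T the arc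
-- u → v is an arc of E⁺ with λ(uv) < λ(vz); so labels increase along the walk and every label
-- at the new vertex u lies below those already used, which keeps the walk simple. The walk
-- stops at x or at a vertex without in-arc, i.e. a collector c; then the out-arc of c is e⁺(c),
-- so the edge {x, c} of the cover has a smaller label and completes the journey.

module Submission where

open import Defs
open import Data.Nat using (ℕ; suc; _≤_; _<_; _<?_; s≤s⁻¹)
open import Data.Nat.Properties using (≤-refl; ≤-trans; ≤-reflexive; ≮⇒≥; ≤∧≢⇒<; ≤-<-trans; <-≤-trans; <⇒≤; <-irrefl; <-asym; <-trans; n<1+n)
open import Data.Fin using (Fin; _≟_)
open import Data.Fin.Properties using (any?; all?)
open import Data.Bool using (true; false)
open import Data.Bool.Properties using () renaming (_≟_ to _≟ᵇ_)
open import Data.List using (List; []; _∷_; _++_)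
open import Data.List.Relation.Unary.All as All using (All; []; _∷_)
open import Data.List.Relation.Unary.AllPairs using ([]; _∷_)
open import Data.List.Relation.Unary.Linked using (Linked; [-]; _∷_)
open import Data.List.Relation.Unary.Unique.Propositional using (Unique)
open import Data.Product using (_×_; ∃; _,_; proj₁; proj₂)
open import Data.Sum using (_⊎_; inj₁; inj₂)
open import Data.Unit using (tt)
open import Data.Empty using (⊥-elim)
open import Relation.Binary.PropositionalEquality using (_≡_; _≢_; refl; sym; trans; subst; ≢-sym)
open import Relation.Nullary using (¬_; Dec; yes; no; ¬?)
open import Relation.Nullary.Decidable using (_×-dec_; _⊎-dec_; _→-dec_)

top-unique : ∀ {n} {lab : Labelling n} {v a b} → Top lab v a → Top lab v b → a ≡ b
top-unique {a = a} {b} (a≢v , a-max) (b≢v , b-max) with a ≟ b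
... | yes a≡b = a≡b
... | no a≢b = ⊥-elim (<-asym (a-max b b≢v (≢-sym a≢b)) (b-max a a≢v a≢b))

arcT? : ∀ {n} (lab : Labelling n) (A : Arcs n) a b → Dec (ArcT lab A a b)
arcT? lab A a b =
     (A a b ≟ᵇ true ×-dec all? (λ u → (A u b ≟ᵇ true) →-dec ¬? (u ≟ a) →-dec lab a b <? lab u b))
  ⊎-dec
     (A b a ≟ᵇ true ×-dec all? (λ u → A u b ≟ᵇ false)
        ×-dec any? (λ u → A u a ≟ᵇ true ×-dec ¬? (u ≟ b) ×-dec lab u a <? lab b a))

collector-or-arcT : ∀ {n} (lab : Labelling n) (A : Arcs n) v →
  Collector lab A v ⊎ ∃ λ u → ArcT lab A u v
collector-or-arcT lab A v with any? (λ u → arcT? lab A u v)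
... | yes arc = inj₂ arc
... | no ¬arc = inj₁ λ u arc → ¬arc (u , arc)

module FireworksCover {n} {lab : Labelling n} (stc : SimpleTemporalClique n lab)
                      {A : Arcs n} (isE : IsEPlus lab A) where

  open SimpleTemporalClique stc

  arc-top : ∀ {a b} → A a b ≡ true → Top lab a b
  arc-top = proj₁ isE _ _

  arc-antisym : ∀ {a b} → A a b ≡ true → ¬ A b a ≡ true
  arc-antisym Aab Aba = proj₂ (proj₂ (proj₂ isE) _ _ (arc-top Aab) (arc-top Aba)) (Aab , Aba)

  arc-≢ : ∀ {a b} → A a b ≡ true → a ≢ b
  arc-≢ Aab = ≢-sym (proj₁ (arc-top Aab))

  arcT-≢ : ∀ {a b} → ArcT lab A a b → a ≢ b
  arcT-≢ (inj₁ (Aab , _))     = arc-≢ Aab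
  arcT-≢ (inj₂ (Aba , _ , _)) = ≢-sym (arc-≢ Aba)

  in-arc-labels-distinct : ∀ {u w v} → A u v ≡ true → A w v ≡ true → u ≢ w → lab u v ≢ lab w v
  in-arc-labels-distinct {u} {w} {v} Auv Awv u≢w eq =
    proper v u w (≢-sym (arc-≢ Auv)) (≢-sym (arc-≢ Awv)) u≢w
      (trans (symmetric v u) (trans eq (symmetric w v)))

  -- The in-arc of least label is kept in E⁺_T; it is found by descending along smaller in-arcs.
  kept-in-arc-below : ∀ k {u v} → lab u v < k → A u v ≡ true → ∃ λ m → ArcT lab A m v
  kept-in-arc-below (suc k) {u} {v} u<k Auv with any? (λ w → (A w v ≟ᵇ true) ×-dec (lab w v <? lab u v))
  ... | yes (w , Awv , w<u) = kept-in-arc-below k (<-≤-trans w<u (s≤s⁻¹ u<k)) Awv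
  ... | no ¬smaller = u , inj₁ (Auv , least)
    where
    least : ∀ w → A w v ≡ true → w ≢ u → lab u v < lab w v
    least w Awv w≢u = ≤∧≢⇒< (≮⇒≥ (λ w<u → ¬smaller (w , Awv , w<u)))
                            (in-arc-labels-distinct Auv Awv (≢-sym w≢u))

  collector-no-in-arc : ∀ {u v} → Collector lab A v → ¬ A u v ≡ true
  collector-no-in-arc {u} {v} c Auv with kept-in-arc-below (suc (lab u v)) (n<1+n _) Auv
  ... | m , kept = c m kept

  collector-arcT-top : ∀ {v z} → Collector lab A v → ArcT lab A v z → Top lab v z
  collector-arcT-top c (inj₁ (Avz , _))              = arc-top Avz
  collector-arcT-top c (inj₂ (_ , _ , _ , Awv , _)) = ⊥-elim (collector-no-in-arc c Awv)

  arcT-chain : ∀ {u v z} → ArcT lab A v z → ArcT lab A u v → A u v ≡ true × lab u v < lab v z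
  arcT-chain {u} {v} {z} (inj₁ (Avz , _)) (inj₁ (Auv , _)) =
    Auv , subst (_< lab v z) (symmetric v u) (proj₂ (arc-top Avz) u (arc-≢ Auv) u≢z)
    where
    u≢z : u ≢ z
    u≢z refl = arc-antisym Avz Auv
  arcT-chain (inj₁ (Avz , kept)) (inj₂ (Avu , _ , w , Awu , w≢v , w<v))
    with refl ← top-unique {lab = lab} (arc-top Avu) (arc-top Avz) =
    ⊥-elim (<-asym w<v (kept w Awu w≢v))
  arcT-chain {u} {v} {z} (inj₂ (Azv , _ , w , Awv , _ , w<z)) (inj₁ (Auv , kept)) =
    Auv , subst (lab u v <_) (symmetric z v) (≤-<-trans u≤w w<z)
    where
    u≤w : lab u v ≤ lab w v
    u≤w with w ≟ u
    ... | yes refl = ≤-refl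
    ... | no w≢u = <⇒≤ (kept w Awv w≢u)
  arcT-chain (inj₂ (_ , _ , _ , Awv , _)) (inj₂ (_ , source-v , _)) with () ← trans (sym Awv) (source-v _)

  module BackwardWalk (x y : Fin n) where

    Cover : Fin n → Fin n → Set
    Cover = InCover lab A

    next : List (Fin n) → Fin n
    next []      = y
    next (m ∷ _) = m

    path : Fin n → List (Fin n) → List (Fin n)
    path v mid = v ∷ mid ++ y ∷ []

    All-next : ∀ {P : Fin n → Set} v mid → All P (path v mid) → P (next mid)
    All-next v []      (_ ∷ p ∷ _) = p
    All-next v (_ ∷ _) (_ ∷ p ∷ _) = p

    increasing-∷ : ∀ u v mid → lab u v < lab v (next mid) →
      IncreasingLabels lab (path v mid) → IncreasingLabels lab (u ∷ path v mid)
    increasing-∷ u v []      u<v inc = u<v , inc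
    increasing-∷ u v (_ ∷ _) u<v inc = u<v , inc

    LabelledAtLeast : ℕ → Fin n → Set
    LabelledAtLeast f z = ∃ λ t → t ≢ z × f ≤ lab z t

    top-below-not-labelled : ∀ {u v f z} → Top lab u v → lab u v < f → LabelledAtLeast f z → u ≢ z
    top-below-not-labelled {u} {v} (_ , u-max) u<f (t , t≢u , f≤t) refl with t ≟ v
    ... | yes refl = <-irrefl refl (<-≤-trans u<f f≤t)
    ... | no t≢v   = <-irrefl refl (<-≤-trans (<-trans (u-max t t≢u t≢v) u<f) f≤t)

    record BackwardJourney (v : Fin n) (mid : List (Fin n)) : Set where
      field
        unique     : Unique (path v mid)
        linked     : Linked Cover (path v mid)
        increasing : IncreasingLabels lab (path v mid)
        first-arc  : ArcT lab A v (next mid)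
        labelled   : All (LabelledAtLeast (lab v (next mid))) (path v mid)

      journey : Journey lab Cover v y
      journey = mid , unique , linked , increasing

    open BackwardJourney

    initial : ∀ {u} → ArcT lab A u y → BackwardJourney u []
    initial {u} arc = record
      { unique     = (u≢y ∷ []) ∷ [] ∷ []
      ; linked     = inj₁ arc ∷ [-]
      ; increasing = tt
      ; first-arc  = arc
      ; labelled   = (y , ≢-sym u≢y , ≤-refl) ∷ (u , u≢y , ≤-reflexive (symmetric u y)) ∷ []
      }
      where
      u≢y : u ≢ y
      u≢y = arcT-≢ arc

    extend : ∀ {u v mid} → A u v ≡ true → ArcT lab A u v → lab u v < lab v (next mid) →
      BackwardJourney v mid → BackwardJourney u (v ∷ mid)
    extend {u} {v} {mid} Auv arc u<v j = record
      { unique     = All.map (top-below-not-labelled (arc-top Auv) u<v) (labelled j) ∷ unique j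
      ; linked     = inj₁ arc ∷ linked j
      ; increasing = increasing-∷ u v mid u<v (increasing j)
      ; first-arc  = arc
      ; labelled   = (v , ≢-sym (arc-≢ Auv) , ≤-refl) ∷ All.map weaken (labelled j)
      }
      where
      weaken : ∀ {z} → LabelledAtLeast (lab v (next mid)) z → LabelledAtLeast (lab u v) z
      weaken (t , t≢z , f≤t) = t , t≢z , ≤-trans (<⇒≤ u<v) f≤t

    prepend-collector : ∀ {v mid} → Collector lab A v → All (x ≢_) (path v mid) →
      BackwardJourney v mid → Journey lab Cover x y
    prepend-collector {v} {mid} c avoid j =
      v ∷ mid , avoid ∷ unique j , inj₂ (inj₂ (inj₂ c)) ∷ linked j ,
      increasing-∷ x v mid x<v (increasing j)
      where
      x<v : lab x v < lab v (next mid)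
      x<v = subst (_< lab v (next mid)) (symmetric v x)
              (proj₂ (collector-arcT-top c (first-arc j)) x (All.head avoid) (All-next v mid avoid))

    walk : ∀ k v mid → lab v (next mid) < k → All (x ≢_) (mid ++ y ∷ []) →
      BackwardJourney v mid → Journey lab Cover x y
    walk (suc k) v mid f<k avoid j with v ≟ x
    ... | yes refl = journey j
    ... | no v≢x with collector-or-arcT lab A v
    ...   | inj₁ c = prepend-collector c (≢-sym v≢x ∷ avoid) j
    ...   | inj₂ (u , arc) with arcT-chain (first-arc j) arc
    ...     | Auv , u<v =
      walk k u (v ∷ mid) (<-≤-trans u<v (s≤s⁻¹ f<k)) (≢-sym v≢x ∷ avoid) (extend Auv arc u<v j)

    spanner : x ≢ y → Journey lab Cover x y
    spanner x≢y with collector-or-arcT lab A y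
    ... | inj₁ c         = [] , (x≢y ∷ []) ∷ [] ∷ [] , inj₂ (inj₂ (inj₂ c)) ∷ [-] , tt
    ... | inj₂ (u , arc) = walk (suc (lab u y)) u [] (n<1+n _) (x≢y ∷ []) (initial arc)

theorem4 : (n : ℕ) → 2 ≤ n → (lab : Labelling n) → SimpleTemporalClique n lab →
    (A : Arcs n) → IsEPlus lab A →
    TemporalSpanner lab (InCover lab A)
theorem4 n _ lab stc A isE x y = BackwardWalk.spanner x y
  where open FireworksCover stc isE
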